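{- Let $t$ be a term and $T$ a testing context. If $\emptyset \vdash T\langle t\rangle : [\,]$ is derivable in system $\mathcal{B}$, then there are an environment $\Gamma$ and a type $\sigma$ such that $\Gamma\vdash t:\sigma$ is derivable in $\mathcal{B}$, every multitype in the image of $\Gamma$ is inhabited, and every element of $\mathrm{args}(\sigma)$ is inhabited.
   Context: Terms: $t ::= x \mid t\,u \mid \lambda x.t \mid\ !t \mid \mathrm{der}(t) \mid t[x\backslash u]$ (binders $\lambda x.t$ and $t[x\backslash u]$ bind $x$ in $t$; terms up to $\alpha$). Testing contexts: $T ::= \langle\cdot\rangle \mid T\,s \mid (\lambda x.T)\,s$ for terms $s$. Types and multitypes: $\sigma,\tau ::= \alpha \mid \mathcal M \mid \mathcal M\to\sigma$ ($\alpha$ a type variable), $\mathcal M ::= [\sigma_i]_{i\in I}$ a finite (possibly empty) multiset of types; $[\,]$ is the empty multitype. An environment $\Gamma$ maps variables to multitypes, all but finitely many to $[\,]$; $\Gamma+\Delta$ is pointwise multiset union; the image of $\Gamma$ is $\{\Gamma(x)\mid \Gamma(x)\neq[\,]\}$; $\emptyset$ maps all variables to $[\,]$. System $\mathcal{B}$ has rules: (var) $x:[\sigma]\vdash x:\sigma$; (abs) from $\Gamma,x:\mathcal M\vdash t:\sigma$ infer $\Gamma\vdash\lambda x.t:\mathcal M\to\sigma$; (app) from $\Gamma\vdash t:\mathcal M\to\sigma$ and $\Delta\vdash u:\mathcal M$ infer $\Gamma+\Delta\vdash t\,u:\sigma$; (es) from $\Gamma,x:\mathcal M\vdash t:\sigma$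 and $\Delta\vdash u:\mathcal M$ infer $\Gamma+\Delta\vdash t[x\backslash u]:\sigma$; (bg) from $(\Gamma_i\vdash t:\sigma_i)_{i\in I}$, $I$ finite possibly empty, infer $+_{i\in I}\Gamma_i\vdash\ !t:[\sigma_i]_{i\in I}$; (dr) from $\Gamma\vdash t:[\sigma]$ infer $\Gamma\vdash\mathrm{der}(t):\sigma$. A type $\sigma$ (including a multitype) is inhabited if $\emptyset\vdash u:\sigma$ is derivable in $\mathcal B$ for some term $u$. $\mathrm{args}(\sigma)$: $\mathrm{args}(\mathcal M)=\emptyset$ for a multitype, $\mathrm{args}(\alpha)=\emptyset$, $\mathrm{args}(\mathcal M\to\sigma)=\{\mathcal M\}\cup\mathrm{args}(\sigma)$. -}

module Defs where

open import Data.Nat using (ℕ; _≟_)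
open import Data.List using (List; []; _∷_; _++_)
open import Data.List.Relation.Unary.All using (All)
open import Data.List.Relation.Binary.Permutation.Homogeneous using (Permutation)
open import Data.List.Relation.Binary.Pointwise using (Pointwise)
open import Data.Product using (Σ; _×_; _,_)
open import Relation.Nullary using (yes; no; ¬_)
open import Relation.Binary.PropositionalEquality using (_≡_)

Var : Set
Var = ℕ

-- Terms (named; binders λ x.t and t[x\u] bind x in t).
data Term : Set where
  var  : Var → Term
  app  : Term → Term → Term
  lam  : Var → Term → Term
  bang : Term → Term
  der  : Term → Term
  esub : Term → Var → Term → Term   -- esub t x u  =  t[x\u]

data TCtx : Set where
  hole  : TCtx
  appT  : TCtx → Term → TCtx
  lamT  : Var → TCtx → Term → TCtx

plug : TCtx → Term → Term
plug hole         t = t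
plug (appT T s)   t = app (plug T t) s
plug (lamT x T s) t = app (lam x (plug T t)) s

-- Types σ ::= α | M | M → σ ; multitypes are finite multisets,
-- represented by lists and compared up to permutation (≈ below).
mutual
  data Ty : Set where
    tvar : ℕ → Ty
    mty  : MTy → Ty
    arr  : MTy → Ty → Ty

  MTy : Set
  MTy = List Ty

mutual
  data _≈T_ : Ty → Ty → Set where
    tvar≈ : ∀ {a} → tvar a ≈T tvar a
    mty≈  : ∀ {M N} → M ≈M N → mty M ≈T mty N
    arr≈  : ∀ {M N σ τ} → M ≈M N → σ ≈T τ → arr M σ ≈T arr N τ

  data _≈M_ : MTy → MTy → Set where
    perm≈ : ∀ {M N} → Permutation _≈T_ M N → M ≈M N

-- Environments: maps from variables to multitypes.
-- (Every environment occurring in a derivation has finite support.)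
Env : Set
Env = Var → MTy

∅ : Env
∅ _ = []

_+E_ : Env → Env → Env
(Γ +E Δ) x = Γ x ++ Δ x

update : Env → Var → MTy → Env
update Γ x M y with x ≟ y
... | yes _ = M
... | no  _ = Γ y

_≈E_ : Env → Env → Set
Γ ≈E Δ = ∀ x → Γ x ≈M Δ x

sumE : List Env → Env
sumE []       = ∅
sumE (Γ ∷ Γs) = Γ +E sumE Γs

envs : List (Env × Ty) → List Env
envs []             = []
envs ((Γ , _) ∷ ds) = Γ ∷ envs ds

tys : List (Env × Ty) → MTy
tys []             = []
tys ((_ , σ) ∷ ds) = σ ∷ tys ds

-- Every rule is closed under replacing the conclusion's
-- environment/type by an equal (≈) one, since multitypes are multisets.
-- In (abs)/(es) the premise environment is written "Γ, x : M", i.e. a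
-- Δ with Δ x = M, and the conclusion environment is Γ = Δ[x ↦ []].
mutual
  data _⊢_∶_ : Env → Term → Ty → Set where
    var : ∀ {Γ x σ} →
          Γ ≈E update ∅ x (σ ∷ []) →
          Γ ⊢ var x ∶ σ
    abs : ∀ {Γ Δ x t σ} →
          Δ ⊢ t ∶ σ →
          Γ ≈E update Δ x [] →
          Γ ⊢ lam x t ∶ arr (Δ x) σ
    app : ∀ {Γ Γ₁ Γ₂ t u M N σ} →
          Γ₁ ⊢ t ∶ arr M σ →
          Γ₂ ⊢ u ∶ mty N →
          M ≈M N →
          Γ ≈E (Γ₁ +E Γ₂) →
          Γ ⊢ app t u ∶ σ
    es  : ∀ {Γ Γ₁ Γ₂ t x u N σ} →
          Γ₁ ⊢ t ∶ σ →
          Γ₂ ⊢ u ∶ mty N →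
          Γ₁ x ≈M N →
          Γ ≈E (update Γ₁ x [] +E Γ₂) →
          Γ ⊢ esub t x u ∶ σ
    bg  : ∀ {Γ t} (ds : List (Env × Ty)) →
          AllDer ds t →
          Γ ≈E sumE (envs ds) →
          Γ ⊢ bang t ∶ mty (tys ds)
    dr  : ∀ {Γ t σ τ} →
          Γ ⊢ t ∶ mty (τ ∷ []) →
          σ ≈T τ →
          Γ ⊢ der t ∶ σ
    conv : ∀ {Γ t σ τ} → Γ ⊢ t ∶ σ → σ ≈T τ → Γ ⊢ t ∶ τ

  data AllDer : List (Env × Ty) → Term → Set where
    nilD  : ∀ {t} → AllDer [] t
    consD : ∀ {Γ σ ds t} → Γ ⊢ t ∶ σ → AllDer ds t → AllDer ((Γ , σ) ∷ ds) t


Inhabited : Ty → Set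
Inhabited σ = Σ Term (λ u → ∅ ⊢ u ∶ σ)

args : Ty → List MTy
args (tvar _)  = []
args (mty _)   = []
args (arr M σ) = M ∷ args σ

-- every multitype in the image of Γ (i.e. every nonempty Γ x) is inhabited
ImageInhabited : Env → Set
ImageInhabited Γ = ∀ x → ¬ (Γ x ≡ []) → Inhabited (mty (Γ x))

-- A realizability argument.  Interpret a type as a set ⟦ σ ⟧ of realizers:
-- a multitype M is realized by a single closed term v with ∅ ⊢ v ∶ τ and a
-- realizer of τ for every τ ∈ M, and an arrow M → σ by a function from
-- realizers of M to realizers of σ.  Typing is sound for this reading; in
-- the bag rule the required closed term is the subject itself with each of
-- its variables x replaced, via t[x\!v], by the term v
-- realizing its environment entry.  Descending a closed derivation of
-- T⟨t⟩ ∶ [] keeps the current environment realized and, by soundness of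
-- each argument s of the spine, collects realizers of the arguments of the
-- type.  A realized multitype M is inhabited by !v.
module Submission where

open import Defs
open import Data.List using (List; []; _∷_; _++_; map)
open import Data.List.Properties using (++-identityʳ)
open import Data.List.Membership.Propositional using (_∉_)
open import Data.List.Membership.Propositional.Properties using (∈-++⁺ˡ; ∈-++⁺ʳ)
open import Data.List.Relation.Unary.All as All using (All; []; _∷_)
open import Data.List.Relation.Unary.Any using (here; there)
open import Data.List.Relation.Binary.Pointwise using (Pointwise; []; _∷_)
open import Data.List.Relation.Binary.Permutation.Homogeneous as Perm using (Permutation)
open import Data.Nat using (_≟_)
open import Data.Product using (Σ; _×_; _,_; proj₁; proj₂)
open import Data.Product.Function.NonDependent.Propositional using (_×-⇔_)
open import Data.Product.Function.Dependent.Propositional using (congˡ)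
open import Data.Unit using (⊤; tt)
open import Data.Empty using (⊥-elim)
open import Function using (_∘_)
open import Function.Bundles using (_⇔_; mk⇔; Equivalence)
open import Function.Related.Propositional using (equivalence)
open import Function.Related.TypeIsomorphisms using (→-cong-⇔)
import Function.Properties.Equivalence as ⇔
open import Relation.Nullary using (yes; no)
open import Relation.Binary.PropositionalEquality
  using (_≡_; _≢_; refl; sym; subst; cong; cong₂)

open Equivalence using (to; from)

private
  variable
    Γ Δ : Env
    M N : MTy
    σ τ : Ty
    t v : Term
    x y : Var

mutual
  ≈T-refl : ∀ σ → σ ≈T σ
  ≈T-refl (tvar _)  = tvar≈
  ≈T-refl (mty M)   = mty≈ (≈M-refl M)
  ≈T-refl (arr M σ) = arr≈ (≈M-refl M) (≈T-refl σ)

  ≈M-refl : ∀ M → M ≈M M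
  ≈M-refl M = perm≈ (≈P-refl M)

  ≈P-refl : ∀ M → Permutation _≈T_ M M
  ≈P-refl []      = Perm.refl []
  ≈P-refl (σ ∷ M) = Perm.prep (≈T-refl σ) (≈P-refl M)

mutual
  ≈T-sym : σ ≈T τ → τ ≈T σ
  ≈T-sym tvar≈      = tvar≈
  ≈T-sym (mty≈ m)   = mty≈ (≈M-sym m)
  ≈T-sym (arr≈ m e) = arr≈ (≈M-sym m) (≈T-sym e)

  ≈M-sym : M ≈M N → N ≈M M
  ≈M-sym (perm≈ p) = perm≈ (≈P-sym p)

  ≈P-sym : Permutation _≈T_ M N → Permutation _≈T_ N M
  ≈P-sym (Perm.refl pw)     = Perm.refl (≈PW-sym pw)
  ≈P-sym (Perm.prep e p)    = Perm.prep (≈T-sym e) (≈P-sym p)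
  ≈P-sym (Perm.swap e f p)  = Perm.swap (≈T-sym f) (≈T-sym e) (≈P-sym p)
  ≈P-sym (Perm.trans p q)   = Perm.trans (≈P-sym q) (≈P-sym p)

  ≈PW-sym : Pointwise _≈T_ M N → Pointwise _≈T_ N M
  ≈PW-sym []       = []
  ≈PW-sym (e ∷ pw) = ≈T-sym e ∷ ≈PW-sym pw

≈M-trans : ∀ {L} → L ≈M M → M ≈M N → L ≈M N
≈M-trans (perm≈ p) (perm≈ q) = perm≈ (Perm.trans p q)

≡⇒≈M : M ≡ N → M ≈M N
≡⇒≈M {M} refl = ≈M-refl M

≈M-[] : M ≈M N → N ≡ [] → M ≡ []
≈M-[] (perm≈ p) refl = Permutation-[] p
  where
  Permutation-[] : ∀ {L} → Permutation _≈T_ L [] → L ≡ []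
  Permutation-[] (Perm.refl [])    = refl
  Permutation-[] (Perm.trans p q) with Permutation-[] q
  ... | refl = Permutation-[] p

≈E-trans : ∀ {Θ} → Θ ≈E Γ → Γ ≈E Δ → Θ ≈E Δ
≈E-trans p q y = ≈M-trans (p y) (q y)

+E-identityʳ : ∀ Γ → Γ ≈E (Γ +E ∅)
+E-identityʳ Γ y = ≡⇒≈M (sym (++-identityʳ (Γ y)))

update-self : ∀ Γ x M → update Γ x M x ≡ M
update-self Γ x M with x ≟ x
... | yes _   = refl
... | no x≢x = ⊥-elim (x≢x refl)

update-other : ∀ Γ {x y} M → x ≢ y → update Γ x M y ≡ Γ y
update-other Γ {x} {y} M x≢y with x ≟ y
... | yes x≡y = ⊥-elim (x≢y x≡y)
... | no _    = refl

update-[]-elim : ∀ (P : MTy → Set) Γ x y → P [] → (x ≢ y → P (Γ y)) →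
  P (update Γ x [] y)
update-[]-elim P Γ x y p[] pΓ with x ≟ y
... | yes _   = p[]
... | no x≢y = pΓ x≢y

⊢-resp-≈E : Δ ≈E Γ → Γ ⊢ t ∶ σ → Δ ⊢ t ∶ σ
⊢-resp-≈E Δ≈Γ (var eq)           = var (≈E-trans Δ≈Γ eq)
⊢-resp-≈E Δ≈Γ (abs d eq)         = abs d (≈E-trans Δ≈Γ eq)
⊢-resp-≈E Δ≈Γ (app d₁ d₂ m eq)   = app d₁ d₂ m (≈E-trans Δ≈Γ eq)
⊢-resp-≈E Δ≈Γ (es d₁ d₂ m eq)    = es d₁ d₂ m (≈E-trans Δ≈Γ eq)
⊢-resp-≈E Δ≈Γ (bg ds ⊢ds eq)     = bg ds ⊢ds (≈E-trans Δ≈Γ eq)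
⊢-resp-≈E Δ≈Γ (dr d e)           = dr (⊢-resp-≈E Δ≈Γ d) e
⊢-resp-≈E Δ≈Γ (conv d e)         = conv (⊢-resp-≈E Δ≈Γ d) e

⊢-resp-≈T : σ ≈T τ → (Γ ⊢ t ∶ σ) ⇔ (Γ ⊢ t ∶ τ)
⊢-resp-≈T e = mk⇔ (λ d → conv d e) (λ d → conv d (≈T-sym e))

-- Binders included: only a superset of the free variables is needed.
vars : Term → List Var
vars (var x)      = x ∷ []
vars (app t u)    = vars t ++ vars u
vars (lam x t)    = x ∷ vars t
vars (bang t)     = vars t
vars (der t)      = vars t
vars (esub t x u) = x ∷ vars t ++ vars u

mutual
  ⊢-support : Γ ⊢ t ∶ σ → y ∉ vars t → Γ y ≡ []
  ⊢-support {y = y} (var {x = x} eq) y∉ =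
    ≈M-[] (eq y) (update-other ∅ _ (λ x≡y → y∉ (here (sym x≡y))))
  ⊢-support {y = y} (abs {Δ = Δ} {x = x} d eq) y∉ =
    ≈M-[] (eq y) (update-[]-elim (_≡ []) Δ x y refl (λ _ → ⊢-support d (y∉ ∘ there)))
  ⊢-support {y = y} (app {t = t} d₁ d₂ _ eq) y∉ =
    ≈M-[] (eq y) (cong₂ _++_ (⊢-support d₁ (y∉ ∘ ∈-++⁺ˡ))
                             (⊢-support d₂ (y∉ ∘ ∈-++⁺ʳ (vars t))))
  ⊢-support {y = y} (es {Γ₁ = Γ₁} {t = t} {x = x} d₁ d₂ _ eq) y∉ =
    ≈M-[] (eq y) (cong₂ _++_
      (update-[]-elim (_≡ []) Γ₁ x y refl (λ _ → ⊢-support d₁ (y∉ ∘ there ∘ ∈-++⁺ˡ)))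
      (⊢-support d₂ (y∉ ∘ there ∘ ∈-++⁺ʳ (vars t))))
  ⊢-support {y = y} (bg ds ⊢ds eq) y∉ = ≈M-[] (eq y) (⊢ᴮ-support ⊢ds y∉)
  ⊢-support (dr d _)   y∉ = ⊢-support d y∉
  ⊢-support (conv d _) y∉ = ⊢-support d y∉

  ⊢ᴮ-support : ∀ {ds} → AllDer ds t → y ∉ vars t → sumE (envs ds) y ≡ []
  ⊢ᴮ-support nilD         y∉ = refl
  ⊢ᴮ-support (consD d ⊢ds) y∉ = cong₂ _++_ (⊢-support d y∉) (⊢ᴮ-support ⊢ds y∉)

mutual
  ⟦_⟧ : Ty → Set
  ⟦ tvar _ ⟧  = ⊤
  ⟦ mty M ⟧   = ⟦ M ⟧ₘ
  ⟦ arr M σ ⟧ = ⟦ M ⟧ₘ → ⟦ σ ⟧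

  ⟦_⟧ₘ : MTy → Set
  ⟦ M ⟧ₘ = Σ Term (_⊩ M)

  _⊩_ : Term → MTy → Set
  v ⊩ []      = ⊤
  v ⊩ (σ ∷ M) = ((∅ ⊢ v ∶ σ) × ⟦ σ ⟧) × v ⊩ M

⟦_⟧ₑ : Env → Set
⟦ Γ ⟧ₑ = ∀ y → ⟦ Γ y ⟧ₘ

mutual
  ⟦⟧-resp : σ ≈T τ → ⟦ σ ⟧ ⇔ ⟦ τ ⟧
  ⟦⟧-resp tvar≈      = ⇔.refl
  ⟦⟧-resp (mty≈ m)   = ⟦⟧ₘ-resp m
  ⟦⟧-resp (arr≈ m e) = →-cong-⇔ (⟦⟧ₘ-resp m) (⟦⟧-resp e)

  ⟦⟧ₘ-resp : M ≈M N → ⟦ M ⟧ₘ ⇔ ⟦ N ⟧ₘ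
  ⟦⟧ₘ-resp m = congˡ {k = equivalence} (⊩-resp m)

  ⊩-resp : M ≈M N → (v ⊩ M) ⇔ (v ⊩ N)
  ⊩-resp (perm≈ p) = ⊩-resp-perm p

  ⊩-resp-perm : Permutation _≈T_ M N → (v ⊩ M) ⇔ (v ⊩ N)
  ⊩-resp-perm (Perm.refl pw)    = ⊩-resp-pointwise pw
  ⊩-resp-perm (Perm.prep e p)   = ⊩¹-resp e ×-⇔ ⊩-resp-perm p
  ⊩-resp-perm (Perm.swap e f p) = mk⇔
    (λ (a , b , r) → to   (⊩¹-resp f) b , to   (⊩¹-resp e) a , to   (⊩-resp-perm p) r)
    (λ (b , a , r) → from (⊩¹-resp e) a , from (⊩¹-resp f) b , from (⊩-resp-perm p) r)
  ⊩-resp-perm (Perm.trans p q)  = ⇔.trans (⊩-resp-perm p) (⊩-resp-perm q)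

  ⊩-resp-pointwise : Pointwise _≈T_ M N → (v ⊩ M) ⇔ (v ⊩ N)
  ⊩-resp-pointwise []       = ⇔.refl
  ⊩-resp-pointwise (e ∷ pw) = ⊩¹-resp e ×-⇔ ⊩-resp-pointwise pw

  ⊩¹-resp : σ ≈T τ → ((∅ ⊢ v ∶ σ) × ⟦ σ ⟧) ⇔ ((∅ ⊢ v ∶ τ) × ⟦ τ ⟧)
  ⊩¹-resp e = ⊢-resp-≈T e ×-⇔ ⟦⟧-resp e

⊩-++ : ∀ M → v ⊩ (M ++ N) → v ⊩ M × v ⊩ N
⊩-++ []      r       = tt , r
⊩-++ (_ ∷ M) (a , r) = let (r₁ , r₂) = ⊩-++ M r in (a , r₁) , r₂

⟦⟧ₑ-resp : Γ ≈E Δ → ⟦ Γ ⟧ₑ → ⟦ Δ ⟧ₑ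
⟦⟧ₑ-resp Γ≈Δ ρ y = to (⟦⟧ₘ-resp (Γ≈Δ y)) (ρ y)

module _ {Γ₁ Γ₂ : Env} (eq : Γ ≈E (Γ₁ +E Γ₂)) (ρ : ⟦ Γ ⟧ₑ) where

  ⟦⟧ₑ-+ˡ : ⟦ Γ₁ ⟧ₑ
  ⟦⟧ₑ-+ˡ y = let (v , r) = ⟦⟧ₑ-resp eq ρ y in v , proj₁ (⊩-++ (Γ₁ y) r)

  ⟦⟧ₑ-+ʳ : ⟦ Γ₂ ⟧ₑ
  ⟦⟧ₑ-+ʳ y = let (v , r) = ⟦⟧ₑ-resp eq ρ y in v , proj₂ (⊩-++ (Γ₁ y) r)

⟦⟧ₑ-extend : ⟦ update Γ x [] ⟧ₑ → ⟦ Γ x ⟧ₘ → ⟦ Γ ⟧ₑ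
⟦⟧ₑ-extend {Γ} {x} ρ a y with x ≟ y
... | yes refl = a
... | no x≢y   = subst ⟦_⟧ₘ (update-other Γ [] x≢y) (ρ y)

⟦∅⟧ₑ : ⟦ ∅ ⟧ₑ
⟦∅⟧ₑ _ = var 0 , tt

⟦[σ]⟧ₘ⇒⟦σ⟧ : ⟦ σ ∷ [] ⟧ₘ → ⟦ σ ⟧
⟦[σ]⟧ₘ⇒⟦σ⟧ (_ , (_ , s) , _) = s

⊩⇒⊢bang : ∀ M → v ⊩ M → ∅ ⊢ bang v ∶ mty M
⊩⇒⊢bang {v} M r = subst (λ L → ∅ ⊢ bang v ∶ mty L) (tys-premises M)
    (bg (premises M) (⊢-premises M r) (∅≈sumE-premises M))
  where
  premises : MTy → List (Env × Ty)
  premises = map (∅ ,_)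

  tys-premises : ∀ M → tys (premises M) ≡ M
  tys-premises []      = refl
  tys-premises (σ ∷ M) = cong (σ ∷_) (tys-premises M)

  ⊢-premises : ∀ M → v ⊩ M → AllDer (premises M) v
  ⊢-premises []      _             = nilD
  ⊢-premises (_ ∷ M) ((d , _) , r) = consD d (⊢-premises M r)

  ∅≈sumE-premises : ∀ M → ∅ ≈E sumE (envs (premises M))
  ∅≈sumE-premises []      y = ≈M-refl []
  ∅≈sumE-premises (_ ∷ M) y = ∅≈sumE-premises M y

⟦⟧ₘ⇒Inhabited : ⟦ M ⟧ₘ → Inhabited (mty M)
⟦⟧ₘ⇒Inhabited {M} (v , r) = bang v , ⊩⇒⊢bang M r

close : (Var → Term) → List Var → Term → Term
close r []       t = t
close r (x ∷ xs) t = close r xs (esub t x (bang (r x)))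

close-typed : ∀ (r : Var → Term) xs → Γ ⊢ t ∶ σ →
  (∀ y → y ∉ xs → Γ y ≡ []) → (∀ y → r y ⊩ Γ y) → ∅ ⊢ close r xs t ∶ σ
close-typed r [] d supported _ =
  ⊢-resp-≈E (λ y → ≡⇒≈M (sym (supported y λ ()))) d
close-typed {Γ} r (x ∷ xs) d supported r⊩Γ =
  close-typed r xs
    (es d (⊩⇒⊢bang (Γ x) (r⊩Γ x)) (≈M-refl (Γ x)) (+E-identityʳ (update Γ x [])))
    supported′ r⊩Γ′
  where
  supported′ : ∀ y → y ∉ xs → update Γ x [] y ≡ []
  supported′ y y∉xs = update-[]-elim (_≡ []) Γ x y refl λ x≢y →
    supported y λ { (here y≡x) → x≢y (sym y≡x) ; (there y∈xs) → y∉xs y∈xs }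

  r⊩Γ′ : ∀ y → r y ⊩ update Γ x [] y
  r⊩Γ′ y = update-[]-elim (r y ⊩_) Γ x y tt (λ _ → r⊩Γ y)

mutual
  sound : Γ ⊢ t ∶ σ → ⟦ Γ ⟧ₑ → ⟦ σ ⟧
  sound (var {x = x} eq) ρ =
    ⟦[σ]⟧ₘ⇒⟦σ⟧ (subst ⟦_⟧ₘ (update-self ∅ x _) (⟦⟧ₑ-resp eq ρ x))
  sound (abs d eq) ρ a = sound d (⟦⟧ₑ-extend (⟦⟧ₑ-resp eq ρ) a)
  sound (app d₁ d₂ m eq) ρ =
    sound d₁ (⟦⟧ₑ-+ˡ eq ρ) (from (⟦⟧ₘ-resp m) (sound d₂ (⟦⟧ₑ-+ʳ eq ρ)))
  sound (es d₁ d₂ m eq) ρ =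
    sound d₁ (⟦⟧ₑ-extend (⟦⟧ₑ-+ˡ eq ρ) (from (⟦⟧ₘ-resp m) (sound d₂ (⟦⟧ₑ-+ʳ eq ρ))))
  sound (bg {t = t} ds ⊢ds eq) ρ =
    close r (vars t) t , sound-bag r ⊢ds (λ y → to (⊩-resp (eq y)) (proj₂ (ρ y)))
    where
    r : Var → Term
    r = proj₁ ∘ ρ
  sound (dr d e)   ρ = from (⟦⟧-resp e) (⟦[σ]⟧ₘ⇒⟦σ⟧ (sound d ρ))
  sound (conv d e) ρ = to (⟦⟧-resp e) (sound d ρ)

  sound-bag : ∀ (r : Var → Term) {ds} → AllDer ds t →
    (∀ y → r y ⊩ sumE (envs ds) y) → close r (vars t) t ⊩ tys ds
  sound-bag r nilD _ = tt
  sound-bag {t} r (consD {Γ = Γ} {ds = ds} d ⊢ds) r⊩Γ =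
    (close-typed r (vars t) d (λ _ → ⊢-support d) r⊩Γᵢ , sound d (λ y → r y , r⊩Γᵢ y))
    , sound-bag r ⊢ds r⊩rest
    where
    r⊩Γᵢ : ∀ y → r y ⊩ Γ y
    r⊩Γᵢ y = proj₁ (⊩-++ (Γ y) (r⊩Γ y))
    r⊩rest : ∀ y → r y ⊩ sumE (envs ds) y
    r⊩rest y = proj₂ (⊩-++ (Γ y) (r⊩Γ y))

⟦args⟧ : Ty → Set
⟦args⟧ σ = All ⟦_⟧ₘ (args σ)

⟦args⟧-resp : σ ≈T τ → ⟦args⟧ τ → ⟦args⟧ σ
⟦args⟧-resp tvar≈      []       = []
⟦args⟧-resp (mty≈ _)   []       = []
⟦args⟧-resp (arr≈ m e) (a ∷ as) = from (⟦⟧ₘ-resp m) a ∷ ⟦args⟧-resp e as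

record RealizedTyping (t : Term) : Set where
  constructor realized
  field
    {env}  : Env
    {type} : Ty
    derivation : env ⊢ t ∶ type
    env-realized : ⟦ env ⟧ₑ
    args-realized : ⟦args⟧ type

app-function : ∀ {f s} → Γ ⊢ app f s ∶ σ → ⟦ Γ ⟧ₑ → ⟦args⟧ σ → RealizedTyping f
app-function (app d₁ d₂ m eq) ρ as =
  realized d₁ (⟦⟧ₑ-+ˡ eq ρ) (from (⟦⟧ₘ-resp m) (sound d₂ (⟦⟧ₑ-+ʳ eq ρ)) ∷ as)
app-function (conv d e) ρ as = app-function d ρ (⟦args⟧-resp e as)

lam-body : Γ ⊢ lam x t ∶ σ → ⟦ Γ ⟧ₑ → ⟦args⟧ σ → RealizedTyping t
lam-body (abs d eq) ρ (a ∷ as) = realized d (⟦⟧ₑ-extend (⟦⟧ₑ-resp eq ρ) a) as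
lam-body (conv d e) ρ as       = lam-body d ρ (⟦args⟧-resp e as)

plug-realized : ∀ T → RealizedTyping (plug T t) → RealizedTyping t
plug-realized hole         R                  = R
plug-realized (appT T _)   (realized d ρ as)  = plug-realized T (app-function d ρ as)
plug-realized (lamT _ T _) (realized d ρ as)
  with realized d′ ρ′ as′ ← app-function d ρ as = plug-realized T (lam-body d′ ρ′ as′)

lemma3p3 : (t : Term) (T : TCtx) →
    ∅ ⊢ plug T t ∶ mty [] →
    Σ Env (λ Γ → Σ Ty (λ σ →
      (Γ ⊢ t ∶ σ) × ImageInhabited Γ × All (λ M → Inhabited (mty M)) (args σ)))
lemma3p3 t T d with realized {Γ} {σ} d′ ρ as ← plug-realized T (realized d ⟦∅⟧ₑ []) =
  Γ , σ , d′ , (λ x _ → ⟦⟧ₘ⇒Inhabited (ρ x)) , All.map ⟦⟧ₘ⇒Inhabited as
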